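{- Let $\Phi_f=(G,F^\times,\varphi,f)$ be a skew gain graph where $G=K_{1,n}$ is a star of order $n+1$. Then $\det(L(\Phi_f))=n-\sum_{\overrightarrow{e}\in E(G)}g(\varphi(\overrightarrow{e}))$.
   Context: $F$ is a field of characteristic zero; $f:F^\times\to F^\times$ is an involutive automorphism and $g(x)=xf(x)$ (so $g(\varphi(\overrightarrow{e}))$ does not depend on the orientation of $e$). A skew gain graph $\Phi_f=(G,F^\times,\varphi,f)$ on an edge-oriented simple graph $G$ assigns to each oriented edge a gain $\varphi(\overrightarrow{uv})\in F^\times$ with $\varphi(\overrightarrow{vu})=f(\varphi(\overrightarrow{uv}))$. Its adjacency matrix $A(\Phi_f)=(a_{ij})$ has $a_{ij}=\varphi(\overrightarrow{v_iv_j})$ if $v_i\sim v_j$, else $0$. $d(v)\in F$ is the degree of $v$ viewed in $F$, $D(\Phi_f)=\mathrm{diag}(d(v_i))$, and $L(\Phi_f)=D(\Phi_f)-A(\Phi_f)$. -}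

module Defs where

open import Level using (Level; _⊔_)
open import Algebra.Bundles using (CommutativeRing)
open import Data.Nat using (ℕ; zero; suc)
open import Data.Fin using (Fin; zero; suc; punchIn; _≟_; toℕ)
open import Data.Bool using (Bool; true; false; if_then_else_; _∨_)
open import Data.Product using (Σ; ∃; proj₁; _,_)
import Data.Product
open import Relation.Nullary using (¬_; does)
open import Relation.Binary.PropositionalEquality using (_≡_)
import Algebra.Definitions.RawMonoid as RawMonoidDefs

module WithRing {c ℓ : Level} (R : CommutativeRing c ℓ) where
  open CommutativeRing R hiding (zero)
  open RawMonoidDefs +-rawMonoid public using (_×_; sum)

  IsField : Set (c ⊔ ℓ)
  IsField = (¬ (1# ≈ 0#)) Data.Product.× (∀ x → ¬ (x ≈ 0#) → ∃ λ y → (x * y) ≈ 1#)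

  CharZero : Set ℓ
  CharZero = ∀ (n : ℕ) → ¬ ((suc n × 1#) ≈ 0#)

  Units : Set (c ⊔ ℓ)
  Units = Σ Carrier (λ x → ¬ (x ≈ 0#))

  val : Units → Carrier
  val = proj₁

  record IsInvolutiveAutomorphism (f : Units → Units) : Set (c ⊔ ℓ) where
    field
      cong       : ∀ x y → val x ≈ val y → val (f x) ≈ val (f y)
      homo       : ∀ x y (p : ¬ ((val x * val y) ≈ 0#)) →
                   val (f (val x * val y , p)) ≈ (val (f x) * val (f y))
      involutive : ∀ x → val (f (f x)) ≈ val x

  g : (Units → Units) → Units → Carrier
  g f x = val x * val (f x)

  sgn : ℕ → Carrier
  sgn zero = 1#
  sgn (suc k) = - sgn k

  det : (n : ℕ) → (Fin n → Fin n → Carrier) → Carrier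
  det zero M = 1#
  det (suc n) M = sum (λ j → (sgn (toℕ j) * M zero j) * det n (λ i k → M (suc i) (punchIn j k)))

  count : (m : ℕ) → (Fin m → Bool) → ℕ
  count zero P = zero
  count (suc m) P = (if P zero then 1 else 0) Data.Nat.+ count m (λ i → P (suc i))

  -- an edge-oriented simple graph on vertex set Fin m:
  -- arc i j = true means there is an edge between i and j, oriented i → j
  record OrientedSimpleGraph (m : ℕ) : Set where
    field
      arc     : Fin m → Fin m → Bool
      irrefl  : ∀ i → arc i i ≡ false
      oneWay  : ∀ i j → arc i j ≡ true → arc j i ≡ false

    adj : Fin m → Fin m → Bool
    adj i j = arc i j ∨ arc j i

    degree : Fin m → ℕ
    degree i = count m (adj i)

  module SkewGain {m : ℕ} (G : OrientedSimpleGraph m) (f : Units → Units)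
                  (φ : Fin m → Fin m → Units) where
    -- φ i j is the gain of the oriented edge i → j (only used when arc i j = true);
    -- the reverse orientation gets gain f (φ i j)
    open OrientedSimpleGraph G

    A : Fin m → Fin m → Carrier
    A i j = if arc i j then val (φ i j) else (if arc j i then val (f (φ j i)) else 0#)

    D : Fin m → Fin m → Carrier
    D i j = if does (i ≟ j) then degree i × 1# else 0#

    L : Fin m → Fin m → Carrier
    L i j = D i j - A i j

    edgeSum : Carrier
    edgeSum = sum (λ i → sum (λ j → if arc i j then g f (φ i j) else 0#))

starAdj : {n : ℕ} → Fin (suc n) → Fin (suc n) → Bool
starAdj zero zero = false
starAdj zero (suc _) = true
starAdj (suc _) zero = true
starAdj (suc _) (suc _) = false

{-# OPTIONS --safe #-}
-- Since every leaf has degree one and no two leaves are adjacent,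
-- L restricted to the leaves is the identity, so L is an arrowhead matrix and
-- det L = L₀₀ − Σⱼ L₀ⱼ Lⱼ₀. Here L₀₀ = deg 0 = n, and for the edge {0, j} with orientation e
-- the two off-diagonal entries are −φ(e) and −f(φ(e)), whose product is g(φ(e)).
module Submission where

open import Defs
open import Level using (Level)
open import Algebra.Bundles using (CommutativeRing)
open import Data.Nat using (ℕ; suc)
open import Data.Fin using (Fin)
open import Relation.Binary.PropositionalEquality using (_≡_)

import Data.Nat as ℕ
open import Data.Bool using (Bool; true; false; if_then_else_)
open import Data.Bool.Properties using (∨-conicalˡ; ∨-conicalʳ)
open import Data.Fin using (zero; suc; punchIn; toℕ; _≟_)
open import Function using (_∘_)
open import Relation.Binary.PropositionalEquality using (_≢_)
import Relation.Binary.PropositionalEquality as ≡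
open import Relation.Nullary using (does; contradiction)
open import Relation.Nullary.Decidable using (dec-true; dec-false)
import Algebra.Properties.CommutativeSemigroup as CommutativeSemigroupProperties
import Algebra.Properties.Ring as RingProperties
import Algebra.Properties.Semiring.Sum as SemiringSum
import Relation.Binary.Reasoning.Setoid as SetoidReasoning

module Laplacian {c ℓ : Level} (R : CommutativeRing c ℓ) where
  open CommutativeRing R hiding (zero)
  open WithRing R
  open RingProperties ring using (-‿distribˡ-*; -‿distribʳ-*; -‿involutive; -0#≈0#; -‿+-comm; -1*x≈-x)
  open CommutativeSemigroupProperties *-commutativeSemigroup using (interchange)
  open SemiringSum semiring using (sum-cong-≋; sum-replicate-zero; ∑-distrib-+)
  open SetoidReasoning setoid

  x-0#≈x : ∀ x → x - 0# ≈ x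
  x-0#≈x x = trans (+-congˡ -0#≈0#) (+-identityʳ x)

  -x*-y≈x*y : ∀ x y → - x * - y ≈ x * y
  -x*-y≈x*y x y = trans (sym (-‿distribˡ-* x (- y))) (trans (-‿cong (sym (-‿distribʳ-* x y))) (-‿involutive _))

  sgn-square : ∀ k → sgn k * sgn k ≈ 1#
  sgn-square ℕ.zero = *-identityˡ 1#
  sgn-square (suc k) = trans (-x*-y≈x*y (sgn k) (sgn k)) (sgn-square k)

  sum-zero : ∀ {n} {t : Fin n → Carrier} → (∀ i → t i ≈ 0#) → sum t ≈ 0#
  sum-zero {n} t≈0 = trans (sum-cong-≋ t≈0) (sum-replicate-zero n)

  sum-negate : ∀ {n} (t : Fin n → Carrier) → sum (λ i → - t i) ≈ - sum t
  sum-negate {ℕ.zero} t = sym -0#≈0#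
  sum-negate {suc n} t = trans (+-congˡ (sum-negate (t ∘ suc))) (-‿+-comm _ _)

  count-cong : ∀ m {p q : Fin m → Bool} → (∀ i → p i ≡ q i) → count m p ≡ count m q
  count-cong ℕ.zero   p≗q = ≡.refl
  count-cong (suc m) p≗q rewrite p≗q zero = ≡.cong (_ ℕ.+_) (count-cong m (p≗q ∘ suc))

  count-true : ∀ m → count m (λ _ → true) ≡ m
  count-true ℕ.zero = ≡.refl
  count-true (suc m) = ≡.cong suc (count-true m)

  count-false : ∀ m → count m (λ _ → false) ≡ 0
  count-false ℕ.zero = ≡.refl
  count-false (suc m) = count-false m

  Matrix : ℕ → Set c
  Matrix n = Fin n → Fin n → Carrier

  identityMatrix : ∀ {n} → Matrix n
  identityMatrix i k = if does (i ≟ k) then 1# else 0#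

  minor : ∀ {n} → Matrix (suc n) → Fin (suc n) → Matrix n
  minor M j i k = M (suc i) (punchIn j k)

  laplaceTerm : ∀ n → Matrix (suc n) → Fin (suc n) → Carrier
  laplaceTerm n M j = (sgn (toℕ j) * M zero j) * det n (minor M j)

  laplaceTerm-zeroEntry : ∀ {n} (M : Matrix (suc n)) {j} → M zero j ≈ 0# → laplaceTerm n M j ≈ 0#
  laplaceTerm-zeroEntry M {j} Mj≈0 = trans (*-congʳ (trans (*-congˡ Mj≈0) (zeroʳ (sgn (toℕ j))))) (zeroˡ _)

  laplaceTerm-zeroMinor : ∀ {n} (M : Matrix (suc n)) {j} → det n (minor M j) ≈ 0# → laplaceTerm n M j ≈ 0#
  laplaceTerm-zeroMinor M det≈0 = trans (*-congˡ det≈0) (zeroʳ _)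

  det-firstRowTailZero : ∀ {n} (M : Matrix (suc n)) → (∀ k → M zero (suc k) ≈ 0#) →
                         det (suc n) M ≈ M zero zero * det n (minor M zero)
  det-firstRowTailZero M tail≈0 = begin
    laplaceTerm _ M zero + sum (laplaceTerm _ M ∘ suc)  ≈⟨ +-cong (*-congʳ (*-identityˡ _)) (sum-zero (laplaceTerm-zeroEntry M ∘ tail≈0)) ⟩
    M zero zero * det _ (minor M zero) + 0#             ≈⟨ +-identityʳ _ ⟩
    M zero zero * det _ (minor M zero)                  ∎

  det-zeroFirstColumn : ∀ n (M : Matrix (suc n)) → (∀ i → M i zero ≈ 0#) → det (suc n) M ≈ 0#

  laplaceTerm-zeroFirstColumn : ∀ n (M : Matrix (suc n)) → (∀ i → M i zero ≈ 0#) → ∀ j → laplaceTerm n M j ≈ 0#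
  laplaceTerm-zeroFirstColumn n       M col≈0 zero    = laplaceTerm-zeroEntry M (col≈0 zero)
  laplaceTerm-zeroFirstColumn (suc n) M col≈0 (suc j) =
    laplaceTerm-zeroMinor M (det-zeroFirstColumn n (minor M (suc j)) (col≈0 ∘ suc))

  det-zeroFirstColumn n M col≈0 = sum-zero (laplaceTerm-zeroFirstColumn n M col≈0)

  det-identity : ∀ n (M : Matrix n) → (∀ i k → M i k ≈ identityMatrix i k) → det n M ≈ 1#
  det-identity ℕ.zero   M M≈I = refl
  det-identity (suc n) M M≈I = begin
    det (suc n) M                      ≈⟨ det-firstRowTailZero M (M≈I zero ∘ suc) ⟩
    M zero zero * det n (minor M zero) ≈⟨ *-cong (M≈I zero zero) (det-identity n _ (λ i k → M≈I (suc i) (suc k))) ⟩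
    1# * 1#                            ≈⟨ *-identityˡ 1# ⟩
    1#                                 ∎

  -- Moving column j to the front is a cyclic shift of j + 1 columns, whence the sign (-1)^j.
  det-identityColumnMovedToFront :
    ∀ m (j : Fin (suc m)) (N : Matrix (suc m)) →
    (∀ i k → N i (suc k) ≈ identityMatrix i (punchIn j k)) →
    det (suc m) N ≈ sgn (toℕ j) * N j zero
  det-identityColumnMovedToFront m zero N N≈I = begin
    det (suc m) N                      ≈⟨ det-firstRowTailZero N (N≈I zero) ⟩
    N zero zero * det m (minor N zero) ≈⟨ *-congˡ (det-identity m _ (λ i → N≈I (suc i))) ⟩
    N zero zero * 1#                   ≈⟨ *-comm _ _ ⟩
    1# * N zero zero                   ∎
  det-identityColumnMovedToFront (suc m) (suc j) N N≈I = begin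
    laplaceTerm (suc m) N zero
      + (laplaceTerm (suc m) N (suc zero) + sum (λ l → laplaceTerm (suc m) N (suc (suc l))))
      ≈⟨ +-cong term₀ (+-cong term₁ (sum-zero (λ l → laplaceTerm-zeroEntry N (N≈I zero (suc l))))) ⟩
    0# + (- (sgn (toℕ j) * N (suc j) zero) + 0#)
      ≈⟨ trans (+-identityˡ _) (trans (+-identityʳ _) (-‿distribˡ-* _ _)) ⟩
    sgn (toℕ (suc j)) * N (suc j) zero
      ∎
    where
    term₀ : laplaceTerm _ N zero ≈ 0#
    term₀ = laplaceTerm-zeroMinor N (det-zeroFirstColumn _ (minor N zero) (λ i → N≈I (suc i) zero))
    term₁ : laplaceTerm _ N (suc zero) ≈ - (sgn (toℕ j) * N (suc j) zero)
    term₁ = begin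
      (- 1# * N zero (suc zero)) * det (suc m) (minor N (suc zero))
        ≈⟨ *-cong (*-congˡ (N≈I zero zero))
                  (det-identityColumnMovedToFront m j (minor N (suc zero)) (λ i k → N≈I (suc i) (suc k))) ⟩
      (- 1# * 1#) * (sgn (toℕ j) * N (suc j) zero)
        ≈⟨ trans (*-congʳ (*-identityʳ _)) (-1*x≈-x _) ⟩
      - (sgn (toℕ j) * N (suc j) zero)
        ∎

  laplaceTerm-arrowhead : ∀ n (M : Matrix (suc n)) → (∀ i k → M (suc i) (suc k) ≈ identityMatrix i k) →
                          ∀ j → laplaceTerm n M (suc j) ≈ - (M zero (suc j) * M (suc j) zero)
  laplaceTerm-arrowhead (suc m) M M≈I j = begin
    (- s * x) * det (suc m) (minor M (suc j))
      ≈⟨ *-congˡ (det-identityColumnMovedToFront m j (minor M (suc j)) (λ i k → M≈I i (punchIn j k))) ⟩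
    (- s * x) * (s * y)                       ≈⟨ *-congʳ (sym (-‿distribˡ-* s x)) ⟩
    - (s * x) * (s * y)                       ≈⟨ sym (-‿distribˡ-* _ _) ⟩
    - ((s * x) * (s * y))                     ≈⟨ -‿cong (interchange s x s y) ⟩
    - ((s * s) * (x * y))                     ≈⟨ -‿cong (trans (*-congʳ (sgn-square (toℕ j))) (*-identityˡ _)) ⟩
    - (x * y)                                 ∎
    where
    s x y : Carrier
    s = sgn (toℕ j)
    x = M zero (suc j)
    y = M (suc j) zero

  det-arrowhead : ∀ n (M : Matrix (suc n)) → (∀ i k → M (suc i) (suc k) ≈ identityMatrix i k) →
                  det (suc n) M ≈ M zero zero - sum (λ j → M zero (suc j) * M (suc j) zero)
  det-arrowhead n M M≈I =
    +-cong head (trans (sum-cong-≋ (laplaceTerm-arrowhead n M M≈I)) (sum-negate (λ j → M zero (suc j) * M (suc j) zero)))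
    where
    head : laplaceTerm n M zero ≈ M zero zero
    head = trans (*-cong (*-identityˡ _) (det-identity n (minor M zero) M≈I)) (*-identityʳ _)

  module SkewGainLaplacian {m : ℕ} (G : OrientedSimpleGraph m) (f : Units → Units)
                           (φ : Fin m → Fin m → Units) where
    open OrientedSimpleGraph G
    open SkewGain G f φ

    edgeWeight : Fin m → Fin m → Carrier
    edgeWeight i j = if arc i j then g f (φ i j) else 0#

    adjacent⇒distinct : ∀ {i j} → adj i j ≡ true → i ≢ j
    adjacent⇒distinct {i} adj≡true ≡.refl rewrite irrefl i = contradiction adj≡true λ ()

    L-diagonal : ∀ i → L i i ≈ degree i × 1#
    L-diagonal i rewrite dec-true (i ≟ i) ≡.refl | irrefl i = x-0#≈x _

    L-nonadjacent : ∀ {i j} → adj i j ≡ false → L i j ≈ D i j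
    L-nonadjacent {i} {j} adj≡false
      rewrite ∨-conicalˡ (arc i j) (arc j i) adj≡false | ∨-conicalʳ (arc i j) (arc j i) adj≡false =
      x-0#≈x _

    edgeWeight-nonadjacent : ∀ {i j} → adj i j ≡ false → edgeWeight i j ≈ 0#
    edgeWeight-nonadjacent {i} {j} adj≡false rewrite ∨-conicalˡ (arc i j) (arc j i) adj≡false = refl

    A-product-adjacent : ∀ {i j} → adj i j ≡ true → A i j * A j i ≈ edgeWeight i j + edgeWeight j i
    A-product-adjacent {i} {j} adj≡true with arc i j in ij | arc j i in ji
    ... | true  | true  = contradiction (≡.trans (≡.sym ji) (oneWay i j ij)) λ ()
    ... | true  | false = sym (+-identityʳ _)
    ... | false | true  = trans (*-comm _ _) (sym (+-identityˡ _))
    ... | false | false = contradiction adj≡true λ ()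

    L-product-adjacent : ∀ {i j} → adj i j ≡ true → L i j * L j i ≈ edgeWeight i j + edgeWeight j i
    L-product-adjacent {i} {j} adj≡true
      rewrite dec-false (i ≟ j) (adjacent⇒distinct adj≡true)
            | dec-false (j ≟ i) (adjacent⇒distinct adj≡true ∘ ≡.sym) = begin
      (0# - A i j) * (0# - A j i) ≈⟨ *-cong (+-identityˡ _) (+-identityˡ _) ⟩
      - A i j * - A j i           ≈⟨ -x*-y≈x*y _ _ ⟩
      A i j * A j i               ≈⟨ A-product-adjacent adj≡true ⟩
      edgeWeight i j + edgeWeight j i ∎

  module Star {n : ℕ} (G : OrientedSimpleGraph (suc n)) (f : Units → Units)
              (φ : Fin (suc n) → Fin (suc n) → Units)
              (star : ∀ i j → OrientedSimpleGraph.adj G i j ≡ starAdj i j) where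
    open OrientedSimpleGraph G
    open SkewGain G f φ
    open SkewGainLaplacian G f φ

    degree-centre : degree zero ≡ n
    degree-centre = ≡.trans (count-cong _ (star zero)) (count-true n)

    degree-leaf : ∀ i → degree (suc i) ≡ 1
    degree-leaf i = ≡.trans (count-cong _ (star (suc i))) (≡.cong suc (count-false n))

    L-leaves : ∀ i k → L (suc i) (suc k) ≈ identityMatrix i k
    L-leaves i k = trans (L-nonadjacent (star (suc i) (suc k))) D-leaves
      where
      D-leaves : D (suc i) (suc k) ≈ identityMatrix i k
      D-leaves rewrite degree-leaf i with does (i ≟ k)
      ... | true  = +-identityʳ 1#
      ... | false = refl

    edgeSum-star : edgeSum ≈ sum (λ j → L zero (suc j) * L (suc j) zero)
    edgeSum-star = begin
      (edgeWeight zero zero + sum (λ j → edgeWeight zero (suc j)))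
        + sum (λ i → edgeWeight (suc i) zero + sum (λ k → edgeWeight (suc i) (suc k)))
        ≈⟨ +-cong (+-congʳ (edgeWeight-nonadjacent (star zero zero)))
                  (sum-cong-≋ {n} (λ i → +-congˡ (sum-zero (λ k → edgeWeight-nonadjacent (star (suc i) (suc k)))))) ⟩
      (0# + sum (λ j → edgeWeight zero (suc j))) + sum (λ i → edgeWeight (suc i) zero + 0#)
        ≈⟨ +-cong (+-identityˡ _) (sum-cong-≋ {n} (λ i → +-identityʳ _)) ⟩
      sum (λ j → edgeWeight zero (suc j)) + sum (λ j → edgeWeight (suc j) zero)
        ≈⟨ ∑-distrib-+ (λ j → edgeWeight zero (suc j)) (λ j → edgeWeight (suc j) zero) ⟨
      sum (λ j → edgeWeight zero (suc j) + edgeWeight (suc j) zero)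
        ≈⟨ sum-cong-≋ (λ j → L-product-adjacent (star zero (suc j))) ⟨
      sum (λ j → L zero (suc j) * L (suc j) zero)
        ∎

    det-L : det (suc n) L ≈ n × 1# - edgeSum
    det-L = begin
      det (suc n) L                                             ≈⟨ det-arrowhead n L L-leaves ⟩
      L zero zero - sum (λ j → L zero (suc j) * L (suc j) zero) ≈⟨ +-cong (L-diagonal zero) (-‿cong (sym edgeSum-star)) ⟩
      degree zero × 1# - edgeSum                                ≡⟨ ≡.cong (λ d → d × 1# - edgeSum) degree-centre ⟩
      n × 1# - edgeSum                                          ∎

mainTheorem7 : {c ℓ : Level} (F : CommutativeRing c ℓ) →
    let open CommutativeRing F in
    let open WithRing F in
    IsField → CharZero →
    (f : Units → Units) → IsInvolutiveAutomorphism f →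
    (n : ℕ) (G : OrientedSimpleGraph (suc n)) →
    (∀ i j → OrientedSimpleGraph.adj G i j ≡ starAdj i j) →
    (φ : Fin (suc n) → Fin (suc n) → Units) →
    det (suc n) (SkewGain.L G f φ) ≈ ((n × 1#) - SkewGain.edgeSum G f φ)
mainTheorem7 F _ _ f _ n G star φ = Laplacian.Star.det-L F G f φ star
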